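{- If $G$ is a graph of order $n$, minimum degree $\delta \ge 1$, and maximum degree $\Delta$, then \[ \gamma_e(G) \ge \frac{\delta n}{2(\Delta + \delta - 1)}. \]
   Context: All graphs are finite, simple and undirected. A matching is a set of pairwise vertex-disjoint edges; it is maximal if it is maximal with respect to inclusion. The edge domination number $\gamma_e(G)$ is the minimum cardinality of a maximal matching of $G$. -}

module Defs where

open import Data.Nat using (ℕ; _≤_)
open import Data.Fin using (Fin)
open import Data.Bool using (Bool; true; false)
open import Data.List using (List; length; filter; allFin)
open import Data.List.Membership.Propositional using (_∈_)
open import Data.List.Relation.Unary.Unique.Propositional using (Unique)
open import Data.Product using (_×_; Σ; ∃; ∃-syntax; _,_)
open import Data.Sum using (_⊎_)
open import Relation.Binary.PropositionalEquality using (_≡_; _≢_)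
open import Relation.Nullary using (¬_)
open import Data.Bool.Properties using (T?)
open import Data.Bool using (T)

record Graph (n : ℕ) : Set where
  field
    adj     : Fin n → Fin n → Bool
    sym     : ∀ u v → adj u v ≡ adj v u
    irrefl  : ∀ v → adj v v ≡ false

module _ {n : ℕ} (G : Graph n) where
  open Graph G

  Adj : Fin n → Fin n → Set
  Adj u v = T (adj u v)

  degree : Fin n → ℕ
  degree v = length (filter (λ u → T? (adj v u)) (allFin n))

  IsMinDegree : ℕ → Set
  IsMinDegree δ = (∃[ v ] degree v ≡ δ) × (∀ v → δ ≤ degree v)

  IsMaxDegree : ℕ → Set
  IsMaxDegree Δ = (∃[ v ] degree v ≡ Δ) × (∀ v → degree v ≤ Δ)

  -- an edge is an (ordered representative of an) adjacent pair
  Edge : Set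
  Edge = Fin n × Fin n

  _covers_ : Edge → Fin n → Set
  (a , b) covers w = (w ≡ a) ⊎ (w ≡ b)

  -- a matching: a duplicate-free list of edges of G, pairwise vertex-disjoint
  -- (distinct edges in the list share no endpoint; with Unique this also
  -- excludes listing the same edge twice in both orientations)
  IsMatching : List Edge → Set
  IsMatching M =
    Unique M ×
    (∀ {e} → e ∈ M → Adj (Data.Product.proj₁ e) (Data.Product.proj₂ e)) ×
    (∀ {e f} → e ∈ M → f ∈ M → e ≢ f → ∀ w → e covers w → ¬ (f covers w))

  IsMaximalMatching : List Edge → Set
  IsMaximalMatching M =
    IsMatching M ×
    (∀ u v → Adj u v → ∃[ e ] (e ∈ M × (e covers u ⊎ e covers v)))

-- Let M be a maximal matching, C the set of vertices it covers and U the rest, so |C| ≤ 2|M|.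
-- Count the adjacent pairs (u , v) with u ∈ U and v ∈ C. By maximality every neighbour of
-- u ∈ U lies in C, so there are at least δ |U| such pairs. Every v ∈ C is matched to a
-- covered neighbour, so it has at most Δ - 1 neighbours in U. Hence δ |U| ≤ (Δ - 1) |C|,
-- and δ n = δ (|U| + |C|) ≤ (Δ + δ - 1) |C| ≤ 2 (Δ + δ - 1) |M|.
module Submission where

open import Defs
open import Data.Nat using (ℕ; zero; suc; _+_; _*_; _∸_; _≤_; _<_; z≤n; s≤s)
open import Data.Nat.Properties
  using (≤-refl; ≤-trans; ≤-reflexive; +-identityʳ; +-mono-≤; +-monoˡ-≤; +-mono-<-≤; +-mono-≤-<;
         *-suc; *-distribʳ-+; *-distribˡ-+; *-monoˡ-≤; ∸-monoˡ-≤; +-∸-comm;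
         +-0-commutativeMonoid; module ≤-Reasoning)
open import Algebra.Properties.CommutativeMonoid.Sum +-0-commutativeMonoid
  using (sum; sum-cong-≗; sum-replicate-zero; ∑-distrib-+; ∑-comm)
open import Data.Bool using (Bool; true; false; not; _∧_; _∨_; T)
open import Data.Bool.Properties using (T?)
open import Data.Empty using (⊥-elim)
open import Data.Fin using (Fin; zero; suc)
open import Data.Fin.Properties using (_≟_)
open import Data.List using (List; []; _∷_; length; filter; tabulate)
open import Data.Bool.ListAction using (any)
open import Data.List.Membership.Propositional using (_∈_; find; lose)
open import Data.List.Relation.Unary.Any.Properties using (any⁺; any⁻)
open import Data.Nat.Solver using (module +-*-Solver)
open import Data.Product using (_×_; _,_; proj₁; proj₂; ∃-syntax)
open import Data.Sum using (_⊎_; inj₁; inj₂)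
open import Function using (_∘_; id)
open import Relation.Binary.PropositionalEquality
  using (_≡_; refl; sym; trans; cong; cong₂; subst; module ≡-Reasoning)
open import Relation.Nullary using (¬_; Dec; does)
open import Relation.Nullary.Decidable using (_⊎-dec_; fromWitness; toWitness; isYes≗does)

T-does⁺ : ∀ {A : Set} (a? : Dec A) → A → T (does a?)
T-does⁺ a? a = subst T (isYes≗does a?) (fromWitness a)

T-does⁻ : ∀ {A : Set} (a? : Dec A) → T (does a?) → A
T-does⁻ a? t = toWitness (subst T (sym (isYes≗does a?)) t)

T-not⇒¬T : ∀ {b} → T (not b) → ¬ T b
T-not⇒¬T {false} _ ()

sum-mono-≤ : ∀ {n} {f g : Fin n → ℕ} → (∀ i → f i ≤ g i) → sum f ≤ sum g
sum-mono-≤ {zero}  f≤g = z≤n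
sum-mono-≤ {suc n} f≤g = +-mono-≤ (f≤g zero) (sum-mono-≤ (f≤g ∘ suc))

sum-mono-< : ∀ {n} {f g : Fin n → ℕ} → (∀ i → f i ≤ g i) → ∀ j → f j < g j → sum f < sum g
sum-mono-< f≤g zero    fj<gj = +-mono-<-≤ fj<gj (sum-mono-≤ (f≤g ∘ suc))
sum-mono-< f≤g (suc j) fj<gj = +-mono-≤-< (f≤g zero) (sum-mono-< (f≤g ∘ suc) j fj<gj)

sum-*ʳ : ∀ {n} (f : Fin n → ℕ) k → sum (λ i → f i * k) ≡ sum f * k
sum-*ʳ {zero}  f k = refl
sum-*ʳ {suc n} f k = trans (cong (f zero * k +_) (sum-*ʳ (f ∘ suc) k))
                           (sym (*-distribʳ-+ k (f zero) (sum (f ∘ suc))))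

𝟙 : Bool → ℕ
𝟙 true  = 1
𝟙 false = 0

count : ∀ {n} → (Fin n → Bool) → ℕ
count p = sum (𝟙 ∘ p)

𝟙-mono-≤ : ∀ {a b} → (T a → T b) → 𝟙 a ≤ 𝟙 b
𝟙-mono-≤ {false}         a⇒b = z≤n
𝟙-mono-≤ {true}  {true}  a⇒b = ≤-refl
𝟙-mono-≤ {true}  {false} a⇒b = ⊥-elim (a⇒b _)

𝟙-mono-< : ∀ {a b} → ¬ T a → T b → 𝟙 a < 𝟙 b
𝟙-mono-< {false} {true} ¬a b = s≤s z≤n
𝟙-mono-< {true}         ¬a b = ⊥-elim (¬a _)

𝟙-∨ : ∀ a b → 𝟙 (a ∨ b) ≤ 𝟙 a + 𝟙 b
𝟙-∨ true  b = s≤s z≤n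
𝟙-∨ false b = ≤-refl

𝟙-*-≤ : ∀ b {k m} → (T b → k ≤ m) → 𝟙 b * k ≤ m
𝟙-*-≤ true  {k} k≤m = subst (_≤ _) (sym (+-identityʳ k)) (k≤m _)
𝟙-*-≤ false     k≤m = z≤n

≤-𝟙-* : ∀ b {k m} → (T b → m ≤ k) → (¬ T b → m ≡ 0) → m ≤ 𝟙 b * k
≤-𝟙-* true  {k} m≤k m≡0 = subst (_ ≤_) (sym (+-identityʳ k)) (m≤k _)
≤-𝟙-* false     m≤k m≡0 = ≤-reflexive (m≡0 (λ ()))

count-mono-≤ : ∀ {n} {p q : Fin n → Bool} → (∀ i → T (p i) → T (q i)) → count p ≤ count q
count-mono-≤ p⇒q = sum-mono-≤ (λ i → 𝟙-mono-≤ (p⇒q i))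

count-mono-< : ∀ {n} {p q : Fin n → Bool} → (∀ i → T (p i) → T (q i)) →
               ∀ j → ¬ T (p j) → T (q j) → count p < count q
count-mono-< p⇒q j ¬pj qj = sum-mono-< (λ i → 𝟙-mono-≤ (p⇒q i)) j (𝟙-mono-< ¬pj qj)

count-none : ∀ {n} (p : Fin n → Bool) → (∀ i → ¬ T (p i)) → count p ≡ 0
count-none {n} p none = trans (sum-cong-≗ (λ i → ¬T⇒𝟙≡0 (none i))) (sum-replicate-zero n)
  where
  ¬T⇒𝟙≡0 : ∀ {b} → ¬ T b → 𝟙 b ≡ 0
  ¬T⇒𝟙≡0 {true}  ¬b = ⊥-elim (¬b _)
  ¬T⇒𝟙≡0 {false} ¬b = refl

count-all : ∀ n → count {n} (λ _ → true) ≡ n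
count-all zero    = refl
count-all (suc n) = cong suc (count-all n)

count-∨ : ∀ {n} (p q : Fin n → Bool) → count (λ i → p i ∨ q i) ≤ count p + count q
count-∨ p q = ≤-trans (sum-mono-≤ (λ i → 𝟙-∨ (p i) (q i))) (≤-reflexive (∑-distrib-+ (𝟙 ∘ p) (𝟙 ∘ q)))

count-not+count : ∀ {n} (p : Fin n → Bool) → count (not ∘ p) + count p ≡ n
count-not+count {n} p = begin
  count (not ∘ p) + count p             ≡⟨ ∑-distrib-+ (𝟙 ∘ not ∘ p) (𝟙 ∘ p) ⟨
  sum (λ i → 𝟙 (not (p i)) + 𝟙 (p i))   ≡⟨ sum-cong-≗ (λ i → 𝟙-not+𝟙 (p i)) ⟩
  count {n} (λ _ → true)                ≡⟨ count-all n ⟩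
  n                                     ∎
  where
  open ≡-Reasoning
  𝟙-not+𝟙 : ∀ b → 𝟙 (not b) + 𝟙 b ≡ 1
  𝟙-not+𝟙 true  = refl
  𝟙-not+𝟙 false = refl

count-≟ : ∀ {n} (a : Fin n) → count (λ i → does (i ≟ a)) ≡ 1
count-≟ {suc n} zero    = cong suc (count-none {n} (λ i → does (suc i ≟ zero)) (λ i ()))
count-≟ {suc n} (suc a) = count-≟ a

count-*-≤-sum : ∀ {n} (p : Fin n → Bool) {f : Fin n → ℕ} {k} →
                (∀ i → T (p i) → k ≤ f i) → count p * k ≤ sum f
count-*-≤-sum p {f} {k} k≤f = begin
  count p * k              ≡⟨ sum-*ʳ (𝟙 ∘ p) k ⟨
  sum (λ i → 𝟙 (p i) * k)  ≤⟨ sum-mono-≤ (λ i → 𝟙-*-≤ (p i) (k≤f i)) ⟩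
  sum f                    ∎
  where open ≤-Reasoning

sum-≤-count-* : ∀ {n} (p : Fin n → Bool) {f : Fin n → ℕ} {k} →
                (∀ i → T (p i) → f i ≤ k) → (∀ i → ¬ T (p i) → f i ≡ 0) → sum f ≤ count p * k
sum-≤-count-* p {f} {k} f≤k f≡0 = begin
  sum f                    ≤⟨ sum-mono-≤ (λ i → ≤-𝟙-* (p i) (f≤k i) (f≡0 i)) ⟩
  sum (λ i → 𝟙 (p i) * k)  ≡⟨ sum-*ʳ (𝟙 ∘ p) k ⟩
  count p * k              ∎
  where open ≤-Reasoning

length-filter-tabulate : ∀ {A : Set} {n} (g : Fin n → A) (p : A → Bool) →
                         length (filter (T? ∘ p) (tabulate g)) ≡ count (p ∘ g)
length-filter-tabulate {n = zero}  g p = refl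
length-filter-tabulate {n = suc n} g p with p (g zero)
... | true  = cong suc (length-filter-tabulate (g ∘ suc) p)
... | false = length-filter-tabulate (g ∘ suc) p

double-count-bound : ∀ {u c m δ d} → u * δ ≤ c * d → c ≤ 2 * m → δ * (u + c) ≤ 2 * (d + δ) * m
double-count-bound {u} {c} {m} {δ} {d} uδ≤cd c≤2m = begin
  δ * (u + c)       ≡⟨ solve 3 (λ u c δ → δ :* (u :+ c) := u :* δ :+ c :* δ) refl u c δ ⟩
  u * δ + c * δ     ≤⟨ +-monoˡ-≤ (c * δ) uδ≤cd ⟩
  c * d + c * δ     ≡⟨ *-distribˡ-+ c d δ ⟨
  c * (d + δ)       ≤⟨ *-monoˡ-≤ (d + δ) c≤2m ⟩
  2 * m * (d + δ)   ≡⟨ solve 2 (λ m x → con 2 :* m :* x := con 2 :* x :* m) refl m (d + δ) ⟩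
  2 * (d + δ) * m   ∎
  where
  open ≤-Reasoning
  open +-*-Solver

module _ {n : ℕ} (G : Graph n) where
  open Graph G using (adj)

  degree≡count : ∀ v → degree G v ≡ count (adj v)
  degree≡count v = length-filter-tabulate id (adj v)

  Adj-sym : ∀ {u v} → Adj G u v → Adj G v u
  Adj-sym {u} {v} = subst T (Graph.sym G u v)

  covers? : ∀ (e : Edge G) w → Dec (_covers_ G e w)
  covers? (a , b) w = w ≟ a ⊎-dec w ≟ b

  covered : List (Edge G) → Fin n → Bool
  covered M w = any (λ e → does (covers? e w)) M

  covered-complete : ∀ {M e w} → e ∈ M → _covers_ G e w → T (covered M w)
  covered-complete {e = e} {w} e∈M e∋w = any⁺ _ (lose e∈M (T-does⁺ (covers? e w) e∋w))

  covered-sound : ∀ M {w} → T (covered M w) → ∃[ e ] (e ∈ M × _covers_ G e w)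
  covered-sound M {w} w∈M with find (any⁻ _ M w∈M)
  ... | e , e∈M , e∋w = e , e∈M , T-does⁻ (covers? e w) e∋w

  count-covered : ∀ M → count (covered M) ≤ 2 * length M
  count-covered []            = ≤-reflexive (count-none {n} (λ _ → false) (λ _ ()))
  count-covered ((a , b) ∷ M) = begin
    count (λ w → does (covers? (a , b) w) ∨ covered M w)
      ≤⟨ count-∨ (λ w → does (covers? (a , b) w)) (covered M) ⟩
    count (λ w → does (w ≟ a) ∨ does (w ≟ b)) + count (covered M)
      ≤⟨ +-mono-≤ (count-∨ (λ w → does (w ≟ a)) (λ w → does (w ≟ b))) (count-covered M) ⟩
    count (λ w → does (w ≟ a)) + count (λ w → does (w ≟ b)) + 2 * length M
      ≡⟨ cong (_+ 2 * length M) (cong₂ _+_ (count-≟ a) (count-≟ b)) ⟩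
    2 + 2 * length M
      ≡⟨ *-suc 2 (length M) ⟨
    2 * length ((a , b) ∷ M) ∎
    where open ≤-Reasoning

  module _ {M : List (Edge G)}
           (edges : ∀ {e} → e ∈ M → Adj G (proj₁ e) (proj₂ e))
           (dominating : ∀ u v → Adj G u v → ∃[ e ] (e ∈ M × (_covers_ G e u ⊎ _covers_ G e v)))
           where

    covered-partner : ∀ {v} → T (covered M v) → ∃[ p ] (Adj G v p × T (covered M p))
    covered-partner v∈M with covered-sound M v∈M
    ... | (a , b) , ab∈M , inj₁ refl = b , edges ab∈M , covered-complete ab∈M (inj₂ refl)
    ... | (a , b) , ab∈M , inj₂ refl = a , Adj-sym (edges ab∈M) , covered-complete ab∈M (inj₁ refl)

    uncovered-neighbour : ∀ {u v} → ¬ T (covered M u) → Adj G u v → T (covered M v)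
    uncovered-neighbour {u} {v} u∉M uv with dominating u v uv
    ... | e , e∈M , inj₁ e∋u = ⊥-elim (u∉M (covered-complete e∈M e∋u))
    ... | e , e∈M , inj₂ e∋v = covered-complete e∈M e∋v

    link : Fin n → Fin n → Bool
    link u v = not (covered M u) ∧ (adj u v ∧ covered M v)

    link-intro : ∀ {u v} → ¬ T (covered M u) → Adj G u v → T (covered M v) → T (link u v)
    link-intro {u} {v} with covered M u | adj u v | covered M v
    ... | true  | _     | _     = λ u∉M _ _ → ⊥-elim (u∉M _)
    ... | false | false | _     = λ _ ()
    ... | false | true  | false = λ _ _ ()
    ... | false | true  | true  = _

    link-elim : ∀ {u v} → T (link u v) → ¬ T (covered M u) × Adj G u v × T (covered M v)
    link-elim {u} {v} with covered M u | adj u v | covered M v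
    ... | true  | _     | _     = λ ()
    ... | false | false | _     = λ ()
    ... | false | true  | false = λ ()
    ... | false | true  | true  = λ _ → (λ ()) , _ , _

    links-from-uncovered : ∀ u → ¬ T (covered M u) → degree G u ≤ count (link u)
    links-from-uncovered u u∉M = begin
      degree G u      ≡⟨ degree≡count u ⟩
      count (adj u)   ≤⟨ count-mono-≤ adj⇒link ⟩
      count (link u)  ∎
      where
      open ≤-Reasoning
      adj⇒link : ∀ v → Adj G u v → T (link u v)
      adj⇒link v uv = link-intro u∉M uv (uncovered-neighbour u∉M uv)

    links-to-covered : ∀ v → T (covered M v) → count (λ u → link u v) < degree G v
    links-to-covered v v∈M with covered-partner v∈M
    ... | p , vp , p∈M = begin-strict
      count (λ u → link u v)  <⟨ count-mono-< link⇒adj p ¬link-p vp ⟩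
      count (adj v)           ≡⟨ degree≡count v ⟨
      degree G v              ∎
      where
      open ≤-Reasoning
      link⇒adj : ∀ u → T (link u v) → Adj G v u
      link⇒adj u l = Adj-sym (proj₁ (proj₂ (link-elim l)))
      ¬link-p : ¬ T (link p v)
      ¬link-p l = proj₁ (link-elim l) p∈M

    links-to-uncovered : ∀ v → ¬ T (covered M v) → count (λ u → link u v) ≡ 0
    links-to-uncovered v v∉M = count-none (λ u → link u v)
      (λ u l → v∉M (proj₂ (proj₂ (link-elim l))))

    uncovered-*-≤-covered-* : ∀ {δ Δ} → (∀ v → δ ≤ degree G v) → (∀ v → degree G v ≤ Δ) →
                              count (not ∘ covered M) * δ ≤ count (covered M) * (Δ ∸ 1)
    uncovered-*-≤-covered-* {δ} {Δ} δ≤deg deg≤Δ = begin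
      count (not ∘ covered M) * δ
        ≤⟨ count-*-≤-sum (not ∘ covered M)
             (λ u u∉M → ≤-trans (δ≤deg u) (links-from-uncovered u (T-not⇒¬T u∉M))) ⟩
      sum (λ u → count (link u))
        ≡⟨ ∑-comm (λ u v → 𝟙 (link u v)) ⟩
      sum (λ v → count (λ u → link u v))
        ≤⟨ sum-≤-count-* (covered M)
             (λ v v∈M → ∸-monoˡ-≤ 1 (≤-trans (links-to-covered v v∈M) (deg≤Δ v)))
             links-to-uncovered ⟩
      count (covered M) * (Δ ∸ 1) ∎
      where open ≤-Reasoning

theorem4 : ∀ {n : ℕ} (G : Graph n) (δ Δ : ℕ) →
    IsMinDegree G δ → 1 ≤ δ → IsMaxDegree G Δ →
    ∀ (M : List (Edge G)) → IsMaximalMatching G M →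
    δ * n ≤ 2 * (Δ + δ ∸ 1) * length M
theorem4 {n} G δ Δ ((w , _) , δ≤deg) 1≤δ (_ , deg≤Δ) M ((_ , edges , _) , dominating) = begin
  δ * n
    ≡⟨ cong (δ *_) (count-not+count (covered G M)) ⟨
  δ * (count (not ∘ covered G M) + count (covered G M))
    ≤⟨ double-count-bound (uncovered-*-≤-covered-* G edges dominating δ≤deg deg≤Δ)
                          (count-covered G M) ⟩
  2 * (Δ ∸ 1 + δ) * length M
    ≡⟨ cong (λ d → 2 * d * length M) (+-∸-comm δ 1≤Δ) ⟨
  2 * (Δ + δ ∸ 1) * length M ∎
  where
  open ≤-Reasoning
  1≤Δ : 1 ≤ Δ
  1≤Δ = ≤-trans 1≤δ (≤-trans (δ≤deg w) (deg≤Δ w))
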